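{- Let $(B_+,\mathcal C_+,B_-,\mathcal C_-;\mathsf{con}_1,\mathsf{tot}_1)$ be a presentation of a pre-d-frame and suppose it satisfies ($\lambda^4_+$), ($\lambda^4_-$), (ind$_+$) and (ind$_-$) below. Then the generated pre-d-frame $(L_+,L_-;\mathsf{Con}_*,\mathsf{Tot}_*)$ satisfies (con-tot): if $\alpha\in\mathsf{Con}_*$, $\beta\in\mathsf{Tot}_*$ and ($\alpha_+=\beta_+$ or $\alpha_-=\beta_-$) then $\alpha\sqsubseteq\beta$. ($\lambda^4_+$): $\alpha\in\mathsf{con}_{\wedge,\bigvee}$, $\beta\in\mathsf{tot}_\wedge$, $\beta_+\le\alpha_+$ imply $\alpha_-\le\beta_-$. ($\lambda^4_-$): $\alpha\in\mathsf{con}_{\vee,\bigwedge}$, $\beta\in\mathsf{tot}_\vee$, $\beta_-\le\alpha_-$ imply $\alpha_+\le\beta_+$. (ind$_+$): $(B_+\times B_-)\cap\downarrow\mathsf{con}_{\wedge,\bigvee}\subseteq\downarrow\mathsf{con}_{\wedge,\vee}$. (ind$_-$): $(B_+\times B_-)\cap\downarrow\mathsf{con}_{\vee,\bigwedge}\subseteq\downarrow\mathsf{con}_{\wedge,\vee}$.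
   Context: A frame presentation $(B,\mathcal C)$: $B$ a meet-semilattice with top, $\mathcal C$ a set of pairs $U\dashv a$ ($a\in B$, $U\subseteq\downarrow a$) with $U\dashv a\in\mathcal C$, $b\le a\Rightarrow\{u\wedge b:u\in U\}\dashv b\in\mathcal C$. $\mathcal C$-ideals are downsets $I\subseteq B$ with $U\dashv a\in\mathcal C,U\subseteq I\Rightarrow a\in I$; they form a frame under inclusion. A presentation of a pre-d-frame is $(B_+,\mathcal C_+,B_-,\mathcal C_-;\mathsf{con}_1,\mathsf{tot}_1)$ with $(B_\pm,\mathcal C_\pm)$ frame presentations and $\mathsf{con}_1,\mathsf{tot}_1\subseteq B_+\times B_-$. Let $L_\pm$ be the frame of $\mathcal C_\pm$-ideals; identify $b\in B_\pm$ with the smallest $\mathcal C_\pm$-ideal containing it, so $B_\pm\subseteq L_\pm$ and $\mathsf{con}_1,\mathsf{tot}_1\subseteq L_+\times L_-$. On $L_+\times L_-$: information order $\alpha\sqsubseteq\beta$ iff $\alpha_+\le\beta_+,\alpha_-\le\beta_-$; logical join $\alpha\vee\beta=(\alpha_+\vee\beta_+,\alpha_-\wedge\beta_-)$, logical meet $\alpha\wedge\beta=(\alpha_+\wedge\beta_+,\alpha_-\vee\beta_-)$; $tt=(1,0)$, $ff=(0,1)$. $\mathsf{Con}_*$ is the smallest relation containing $\mathsf{con}_1$, $tt,ff$ that is $\sqsubseteq$-downward closed and closed under logical $\wedge,\vee$ and coordinatewise joins of $\sqsubseteq$-directed sets; $\mathsf{Tot}_*$ the smallest containing $\mathsf{tot}_1$,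 $tt,ff$, $\sqsubseteq$-upward closed and closed under logical $\wedge,\vee$. $\mathsf{con}_\wedge$, $\mathsf{con}_\vee$, $\mathsf{con}_{\wedge,\vee}$ denote the closures of $\mathsf{con}_1$ under all finite logical meets, finite logical joins, and both, respectively (similarly $\mathsf{tot}_\wedge,\mathsf{tot}_\vee$). $\mathsf{con}_{\wedge,\bigvee}=\{(\bigvee_i\alpha^i_+,\bigwedge_i\alpha^i_-):\{\alpha^i\}_i\subseteq\mathsf{con}_\wedge\}$ (arbitrary families) and $\mathsf{con}_{\vee,\bigwedge}=\{(\bigwedge_i\alpha^i_+,\bigvee_i\alpha^i_-):\{\alpha^i\}_i\subseteq\mathsf{con}_\vee\}$. $\downarrow R$ is the $\sqsubseteq$-downward closure. -}

module Defs where

open import Level using (0ℓ)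
open import Data.Product using (Σ; ∃; _×_; _,_; proj₁; proj₂)
open import Data.Sum using (_⊎_)
open import Data.Empty using (⊥)
open import Data.Unit renaming (⊤ to Unit) using (tt)
open import Relation.Binary.Lattice.Bundles using (BoundedMeetSemilattice)

-- A cover U ⊣ a is represented as a
-- family  elem c : Idx c → B  (its image is the subset U), indexed by
-- c : Cov a.  (Every subset is a family indexed by its own elements, and
-- C-ideals only depend on the image, so this is a faithful encoding.)

record FramePres : Set₁ where
  field
    SL   : BoundedMeetSemilattice 0ℓ 0ℓ 0ℓ
  open BoundedMeetSemilattice SL public
  field
    Cov  : Carrier → Set
    Idx  : ∀ {a} → Cov a → Set
    elem : ∀ {a} (c : Cov a) → Idx c → Carrier
    elem≤ : ∀ {a} (c : Cov a) (i : Idx c) → elem c i ≤ a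
    stable : ∀ {a b} (c : Cov a) → b ≤ a →
      Σ (Cov b) λ c′ →
        (∀ j → ∃ λ i → elem c′ j ≈ (elem c i ∧ b)) ×
        (∀ i → ∃ λ j → elem c′ j ≈ (elem c i ∧ b))

module FP (P : FramePres) where
  open FramePres P

  record Ideal : Set₁ where
    field
      mem    : Carrier → Set
      down   : ∀ {a b} → b ≤ a → mem a → mem b
      closed : ∀ {a} (c : Cov a) → (∀ i → mem (elem c i)) → mem a
  open Ideal public

  _⊆ᴵ_ : Ideal → Ideal → Set
  I ⊆ᴵ J = ∀ {a} → mem I a → mem J a

  _≅ᴵ_ : Ideal → Ideal → Set
  I ≅ᴵ J = (I ⊆ᴵ J) × (J ⊆ᴵ I)

  data Gen (S : Carrier → Set) : Carrier → Set where
    inc : ∀ {a} → S a → Gen S a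
    dn  : ∀ {a b} → b ≤ a → Gen S a → Gen S b
    cov : ∀ {a} (c : Cov a) → (∀ i → Gen S (elem c i)) → Gen S a

  gen : (Carrier → Set) → Ideal
  gen S = record { mem = Gen S ; down = dn ; closed = cov }

  ↑ : Carrier → Ideal
  ↑ b = gen (λ x → x ≈ b)

  𝟙 : Ideal
  𝟙 = record { mem = λ _ → Unit ; down = λ _ _ → tt ; closed = λ _ _ → tt }

  𝟘 : Ideal
  𝟘 = gen (λ _ → ⊥)

  _∧ᴵ_ : Ideal → Ideal → Ideal
  I ∧ᴵ J = record
    { mem = λ a → mem I a × mem J a
    ; down = λ p (x , y) → down I p x , down J p y
    ; closed = λ c h → closed I c (λ i → proj₁ (h i)) , closed J c (λ i → proj₂ (h i)) }

  _∨ᴵ_ : Ideal → Ideal → Ideal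
  I ∨ᴵ J = gen (λ a → mem I a ⊎ mem J a)

  ⋀ᴵ : {X : Set} → (X → Ideal) → Ideal
  ⋀ᴵ {X} f = record
    { mem = λ a → (x : X) → mem (f x) a
    ; down = λ p h x → down (f x) p (h x)
    ; closed = λ c h x → closed (f x) c (λ i → h i x) }

  ⋁ᴵ : {X : Set} → (X → Ideal) → Ideal
  ⋁ᴵ {X} f = gen (λ a → Σ X λ x → mem (f x) a)

record PreDPres : Set₁ where
  field
    P₊ P₋ : FramePres
  module B₊ = FramePres P₊
  module B₋ = FramePres P₋
  field
    con₁ tot₁ : B₊.Carrier → B₋.Carrier → Set

module PD (Π : PreDPres) where
  open PreDPres Π
  module L₊ = FP P₊
  module L₋ = FP P₋

  Pair : Set₁
  Pair = L₊.Ideal × L₋.Ideal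

  _₊ : Pair → L₊.Ideal
  _₊ = proj₁
  _₋ : Pair → L₋.Ideal
  _₋ = proj₂

  _⊑_ : Pair → Pair → Set
  α ⊑ β = ((α ₊) L₊.⊆ᴵ (β ₊)) × ((α ₋) L₋.⊆ᴵ (β ₋))

  _∨ₗ_ : Pair → Pair → Pair
  α ∨ₗ β = ((α ₊) L₊.∨ᴵ (β ₊)) , ((α ₋) L₋.∧ᴵ (β ₋))

  _∧ₗ_ : Pair → Pair → Pair
  α ∧ₗ β = ((α ₊) L₊.∧ᴵ (β ₊)) , ((α ₋) L₋.∨ᴵ (β ₋))

  ttₗ ffₗ : Pair
  ttₗ = L₊.𝟙 , L₋.𝟘
  ffₗ = L₊.𝟘 , L₋.𝟙

  ⟦_,_⟧ : B₊.Carrier → B₋.Carrier → Pair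
  ⟦ a , b ⟧ = L₊.↑ a , L₋.↑ b

  Directed : {X : Set} → (X → Pair) → Set
  Directed {X} f = X × (∀ x y → ∃ λ z → (f x ⊑ f z) × (f y ⊑ f z))

  dirJoin : {X : Set} → (X → Pair) → Pair
  dirJoin f = L₊.⋁ᴵ (λ x → f x ₊) , L₋.⋁ᴵ (λ x → f x ₋)

  data Con* : Pair → Set₁ where
    c-base : ∀ {a b} → con₁ a b → Con* ⟦ a , b ⟧
    c-tt   : Con* ttₗ
    c-ff   : Con* ffₗ
    c-down : ∀ {α β} → β ⊑ α → Con* α → Con* β
    c-∧    : ∀ {α β} → Con* α → Con* β → Con* (α ∧ₗ β)
    c-∨    : ∀ {α β} → Con* α → Con* β → Con* (α ∨ₗ β)
    c-dir  : ∀ {X : Set} (f : X → Pair) → Directed f →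
             (∀ x → Con* (f x)) → Con* (dirJoin f)

  data Tot* : Pair → Set₁ where
    t-base : ∀ {a b} → tot₁ a b → Tot* ⟦ a , b ⟧
    t-tt   : Tot* ttₗ
    t-ff   : Tot* ffₗ
    t-up   : ∀ {α β} → α ⊑ β → Tot* α → Tot* β
    t-∧    : ∀ {α β} → Tot* α → Tot* β → Tot* (α ∧ₗ β)
    t-∨    : ∀ {α β} → Tot* α → Tot* β → Tot* (α ∨ₗ β)

  data Con∧ : Pair → Set₁ where
    base : ∀ {a b} → con₁ a b → Con∧ ⟦ a , b ⟧
    top  : Con∧ ttₗ
    meet : ∀ {α β} → Con∧ α → Con∧ β → Con∧ (α ∧ₗ β)

  data Con∨ : Pair → Set₁ where
    base : ∀ {a b} → con₁ a b → Con∨ ⟦ a , b ⟧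
    bot  : Con∨ ffₗ
    join : ∀ {α β} → Con∨ α → Con∨ β → Con∨ (α ∨ₗ β)

  data Con∧∨ : Pair → Set₁ where
    base : ∀ {a b} → con₁ a b → Con∧∨ ⟦ a , b ⟧
    top  : Con∧∨ ttₗ
    bot  : Con∧∨ ffₗ
    meet : ∀ {α β} → Con∧∨ α → Con∧∨ β → Con∧∨ (α ∧ₗ β)
    join : ∀ {α β} → Con∧∨ α → Con∧∨ β → Con∧∨ (α ∨ₗ β)

  data Tot∧ : Pair → Set₁ where
    base : ∀ {a b} → tot₁ a b → Tot∧ ⟦ a , b ⟧
    top  : Tot∧ ttₗ
    meet : ∀ {α β} → Tot∧ α → Tot∧ β → Tot∧ (α ∧ₗ β)

  data Tot∨ : Pair → Set₁ where
    base : ∀ {a b} → tot₁ a b → Tot∨ ⟦ a , b ⟧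
    bot  : Tot∨ ffₗ
    join : ∀ {α β} → Tot∨ α → Tot∨ β → Tot∨ (α ∨ₗ β)

  data Con∧⋁ : Pair → Set₁ where
    mk : ∀ {X : Set} (f : X → Pair) → (∀ x → Con∧ (f x)) →
         Con∧⋁ (L₊.⋁ᴵ (λ x → f x ₊) , L₋.⋀ᴵ (λ x → f x ₋))

  data Con∨⋀ : Pair → Set₁ where
    mk : ∀ {X : Set} (f : X → Pair) → (∀ x → Con∨ (f x)) →
         Con∨⋀ (L₊.⋀ᴵ (λ x → f x ₊) , L₋.⋁ᴵ (λ x → f x ₋))

  ↓ : (Pair → Set₁) → Pair → Set₁
  ↓ R α = Σ Pair λ β → (α ⊑ β) × R β

  λ4₊ : Set₁
  λ4₊ = ∀ α β → Con∧⋁ α → Tot∧ β → (β ₊) L₊.⊆ᴵ (α ₊) → (α ₋) L₋.⊆ᴵ (β ₋)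

  λ4₋ : Set₁
  λ4₋ = ∀ α β → Con∨⋀ α → Tot∨ β → (β ₋) L₋.⊆ᴵ (α ₋) → (α ₊) L₊.⊆ᴵ (β ₊)

  ind₊ : Set₁
  ind₊ = ∀ a b → ↓ Con∧⋁ ⟦ a , b ⟧ → ↓ Con∧∨ ⟦ a , b ⟧

  ind₋ : Set₁
  ind₋ = ∀ a b → ↓ Con∨⋀ ⟦ a , b ⟧ → ↓ Con∧∨ ⟦ a , b ⟧

  con-tot : Set₁
  con-tot = ∀ α β → Con* α → Tot* β →
            (((α ₊) L₊.≅ᴵ (β ₊)) ⊎ ((α ₋) L₋.≅ᴵ (β ₋))) → α ⊑ β

-- By symmetry (the opposite presentation swaps the two sides) it suffices to treat
-- α₊ = β₊.  First, every α ∈ Con* satisfies (B₊ × B₋) ∩ ↓α ⊆ ↓con_{∧,∨}: for fixed b the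
-- a with ⟦a,b⟧ ∈ ↓con_{∧,∨} form a C₊-ideal, since below ⟦a,b⟧ an element of con_{∧,∨} may
-- be replaced by one of con_{∧,⋁}, where witnesses for the members of a cover can be
-- glued, and (ind₊) leads back; dually in b with (ind₋).  Next, for β ∈ tot_∧ with
-- β₊ ⊆ α₊, gluing the con_{∧,⋁} witnesses of all ⟦a,b⟧ with a ∈ β₊ and b ∈ α₋ gives one
-- element of con_{∧,⋁} to which (λ⁴₊) applies, so α₋ ⊆ β₋.  Finally, by distributivity,
-- every element of Tot* lies above a finite logical join of elements of tot_∧.

module Submission where

open import Function using (_∘_; flip)
open import Data.Product using (Σ; _×_; _,_; proj₁; proj₂; swap)
open import Data.Sum using (_⊎_; inj₁; inj₂; [_,_]′)
import Data.Sum as Sum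
open import Data.Empty using (⊥)
open import Data.Unit renaming (⊤ to Unit) using (tt)
open import Defs

module FrameLemmas (P : FramePres) where
  open FramePres P
  open FP P

  Gen-ind : ∀ {ℓ} {S : Carrier → Set} (R : Carrier → Set ℓ) →
    (∀ {a} → S a → R a) → (∀ {a b} → b ≤ a → R a → R b) →
    (∀ {a} (c : Cov a) → (∀ i → R (elem c i)) → R a) →
    ∀ {a} → Gen S a → R a
  Gen-ind R inc′ dn′ cov′ (inc s)    = inc′ s
  Gen-ind R inc′ dn′ cov′ (dn b≤a g) = dn′ b≤a (Gen-ind R inc′ dn′ cov′ g)
  Gen-ind R inc′ dn′ cov′ (cov c gs) = cov′ c (λ i → Gen-ind R inc′ dn′ cov′ (gs i))

  gen-least : ∀ {S} (I : Ideal) → (∀ {a} → S a → mem I a) → gen S ⊆ᴵ I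
  gen-least I S⊆I = Gen-ind (mem I) S⊆I (down I) (closed I)

  gen-mono : ∀ {S T} → (∀ {a} → S a → T a) → gen S ⊆ᴵ gen T
  gen-mono {T = T} S⊆T = gen-least (gen T) (inc ∘ S⊆T)

  ↑-self : ∀ {a} → mem (↑ a) a
  ↑-self = inc Eq.refl

  ↑-least : (I : Ideal) → ∀ {a} → mem I a → ↑ a ⊆ᴵ I
  ↑-least I a∈I = gen-least I (λ x≈a → down I (reflexive x≈a) a∈I)

  𝟘-least : (I : Ideal) → 𝟘 ⊆ᴵ I
  𝟘-least I = gen-least I (λ ())

  -- The Heyting implication ↑ b ⇒ I; as it is an ideal, distributivity follows from gen-least.
  _⇒_ : Ideal → Carrier → Ideal
  I ⇒ b = record
    { mem    = λ a → mem I (a ∧ b)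
    ; down   = λ a′≤a → down I (∧-mono a′≤a)
    ; closed = closed⇒ }
    where
    ∧-mono : ∀ {a a′} → a′ ≤ a → a′ ∧ b ≤ a ∧ b
    ∧-mono {a} {a′} a′≤a = ∧-greatest (trans (x∧y≤x a′ b) a′≤a) (x∧y≤y a′ b)

    closed⇒ : ∀ {a} (c : Cov a) → (∀ i → mem I (elem c i ∧ b)) → mem I (a ∧ b)
    closed⇒ {a} c h with stable c (x∧y≤x a b)
    ... | c′ , restrict , _ = closed I c′ λ j →
      let i , e = restrict j in
      down I (trans (reflexive e) (∧-greatest (x∧y≤x _ _) (trans (x∧y≤y _ _) (x∧y≤y a b)))) (h i)

  DownSet : (Carrier → Set) → Set
  DownSet S = ∀ {a b} → b ≤ a → S a → S b

  Gen-∩ : ∀ {S T} → DownSet S → DownSet T →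
    ∀ {a} → Gen S a → Gen T a → Gen (λ x → S x × T x) a
  Gen-∩ {S} {T} S↓ T↓ {a} gs gt = dn (∧-greatest refl refl) (T⊆ gt gs)
    where
    S∩T = gen (λ x → S x × T x)

    S⊆ : ∀ {u} → S u → gen T ⊆ᴵ (S∩T ⇒ u)
    S⊆ {u} s = gen-least (S∩T ⇒ u) λ {b} t → inc (S↓ (x∧y≤y b u) s , T↓ (x∧y≤x b u) t)

    T⊆ : ∀ {b} → Gen T b → gen S ⊆ᴵ (S∩T ⇒ b)
    T⊆ {b} gt = gen-least (S∩T ⇒ b) λ {a′} s →
      dn (∧-greatest (x∧y≤y a′ b) (x∧y≤x a′ b)) (S⊆ s gt)

  DownSet-⊎ : ∀ {S T} → DownSet S → DownSet T → DownSet (λ a → S a ⊎ T a)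
  DownSet-⊎ S↓ T↓ b≤a = Sum.map (S↓ b≤a) (T↓ b≤a)

  ∨ᴵ-distribˡ-∧ᴵ : (I J K : Ideal) → ((I ∨ᴵ J) ∧ᴵ (I ∨ᴵ K)) ⊆ᴵ (I ∨ᴵ (J ∧ᴵ K))
  ∨ᴵ-distribˡ-∧ᴵ I J K (g , h) =
    gen-mono regroup (Gen-∩ (DownSet-⊎ (down I) (down J)) (DownSet-⊎ (down I) (down K)) g h)
    where
    regroup : ∀ {a} → (mem I a ⊎ mem J a) × (mem I a ⊎ mem K a) → mem I a ⊎ (mem J a × mem K a)
    regroup (inj₁ i , _)     = inj₁ i
    regroup (inj₂ _ , inj₁ i) = inj₁ i
    regroup (inj₂ j , inj₂ k) = inj₂ (j , k)

  ∨ᴵ-distribʳ-∧ᴵ : (I J K : Ideal) → ((J ∨ᴵ I) ∧ᴵ (K ∨ᴵ I)) ⊆ᴵ ((J ∧ᴵ K) ∨ᴵ I)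
  ∨ᴵ-distribʳ-∧ᴵ I J K (g , h) =
    gen-mono Sum.swap (∨ᴵ-distribˡ-∧ᴵ I J K (gen-mono Sum.swap g , gen-mono Sum.swap h))

  ⋁ᴵ-∧ᴵ : {X Y : Set} (f : X → Ideal) (g : Y → Ideal) →
    ((⋁ᴵ f) ∧ᴵ (⋁ᴵ g)) ⊆ᴵ ⋁ᴵ (λ (xy : X × Y) → f (proj₁ xy) ∧ᴵ g (proj₂ xy))
  ⋁ᴵ-∧ᴵ f g (u , v) =
    gen-mono (λ ((x , s) , (y , t)) → (x , y) , (s , t)) (Gen-∩ (Σ↓ f) (Σ↓ g) u v)
    where
    Σ↓ : ∀ {X} (h : X → Ideal) → DownSet (λ a → Σ X λ x → mem (h x) a)
    Σ↓ h b≤a (x , m) = x , down (h x) b≤a m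

module Pairs (Π : PreDPres) where
  open PreDPres Π
  open PD Π
  module F₊ = FrameLemmas P₊
  module F₋ = FrameLemmas P₋

  -- ⊑ is a function into a product, so Agda cannot infer the pairs it relates;
  -- this record copy of it can be inferred from.
  record _⊑′_ (α β : Pair) : Set where
    constructor ⟨_,_⟩
    field
      ⊆₊ : (α ₊) L₊.⊆ᴵ (β ₊)
      ⊆₋ : (α ₋) L₋.⊆ᴵ (β ₋)
  open _⊑′_ public

  ⊑⇒⊑′ : ∀ {α β} → α ⊑ β → α ⊑′ β
  ⊑⇒⊑′ (p , q) = ⟨ p , q ⟩

  ⊑′⇒⊑ : ∀ {α β} → α ⊑′ β → α ⊑ β
  ⊑′⇒⊑ ⟨ p , q ⟩ = p , q

  ⊑′-refl : ∀ {α} → α ⊑′ α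
  ⊑′-refl = ⟨ (λ u → u) , (λ v → v) ⟩

  ⊑′-trans : ∀ {α β γ} → α ⊑′ β → β ⊑′ γ → α ⊑′ γ
  ⊑′-trans ⟨ p , q ⟩ ⟨ p′ , q′ ⟩ = ⟨ (λ u → p′ (p u)) , (λ v → q′ (q v)) ⟩

  ∧ₗ-mono : ∀ {α β γ δ} → α ⊑′ β → γ ⊑′ δ → (α ∧ₗ γ) ⊑′ (β ∧ₗ δ)
  ∧ₗ-mono ⟨ p , q ⟩ ⟨ p′ , q′ ⟩ = ⟨ (λ (u , v) → p u , p′ v) , F₋.gen-mono (Sum.map q q′) ⟩

  ∨ₗ-mono : ∀ {α β γ δ} → α ⊑′ β → γ ⊑′ δ → (α ∨ₗ γ) ⊑′ (β ∨ₗ δ)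
  ∨ₗ-mono ⟨ p , q ⟩ ⟨ p′ , q′ ⟩ = ⟨ F₊.gen-mono (Sum.map p p′) , (λ (u , v) → q u , q′ v) ⟩

  ∧ₗ-distribˡ-∨ₗ : ∀ γ α β → ((γ ∧ₗ α) ∨ₗ (γ ∧ₗ β)) ⊑′ (γ ∧ₗ (α ∨ₗ β))
  ∧ₗ-distribˡ-∨ₗ γ α β = ⟨
    F₊.gen-least ((γ ₊) L₊.∧ᴵ ((α ₊) L₊.∨ᴵ (β ₊)))
      (λ { (inj₁ (g , a)) → g , L₊.inc (inj₁ a) ; (inj₂ (g , b)) → g , L₊.inc (inj₂ b) }) ,
    F₋.∨ᴵ-distribˡ-∧ᴵ (γ ₋) (α ₋) (β ₋) ⟩

  ∧ₗ-distribʳ-∨ₗ : ∀ γ α β → ((α ∧ₗ γ) ∨ₗ (β ∧ₗ γ)) ⊑′ ((α ∨ₗ β) ∧ₗ γ)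
  ∧ₗ-distribʳ-∨ₗ γ α β = ⟨
    F₊.gen-least (((α ₊) L₊.∨ᴵ (β ₊)) L₊.∧ᴵ (γ ₊))
      (λ { (inj₁ (a , g)) → L₊.inc (inj₁ a) , g ; (inj₂ (b , g)) → L₊.inc (inj₂ b) , g }) ,
    F₋.∨ᴵ-distribʳ-∧ᴵ (γ ₋) (α ₋) (β ₋) ⟩

  ffₗ⊑′ffₗ∧ₗ : ∀ γ → ffₗ ⊑′ (ffₗ ∧ₗ γ)
  ffₗ⊑′ffₗ∧ₗ γ = ⟨ F₊.𝟘-least (L₊.𝟘 L₊.∧ᴵ (γ ₊)) , (λ v → L₋.inc (inj₁ v)) ⟩

  ffₗ⊑′∧ₗffₗ : ∀ γ → ffₗ ⊑′ (γ ∧ₗ ffₗ)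
  ffₗ⊑′∧ₗffₗ γ = ⟨ F₊.𝟘-least ((γ ₊) L₊.∧ᴵ L₊.𝟘) , (λ v → L₋.inc (inj₂ v)) ⟩

  ⟦⟧⊑′ : ∀ {γ a b} → L₊.mem (γ ₊) a → L₋.mem (γ ₋) b → ⟦ a , b ⟧ ⊑′ γ
  ⟦⟧⊑′ {γ} a∈γ₊ b∈γ₋ = ⟨ F₊.↑-least (γ ₊) a∈γ₊ , F₋.↑-least (γ ₋) b∈γ₋ ⟩

  ⋁ₗ : {X : Set} → (X → Pair) → Pair
  ⋁ₗ f = L₊.⋁ᴵ (λ x → f x ₊) , L₋.⋀ᴵ (λ x → f x ₋)

  ⊑′⋁ₗ-singleton : ∀ {γ} → γ ⊑′ ⋁ₗ {Unit} (λ _ → γ)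
  ⊑′⋁ₗ-singleton = ⟨ (λ u → L₊.inc (tt , u)) , (λ v _ → v) ⟩

  ffₗ⊑′⋁ₗ-empty : ffₗ ⊑′ ⋁ₗ {⊥} (λ ())
  ffₗ⊑′⋁ₗ-empty = ⟨ F₊.𝟘-least (L₊.⋁ᴵ {⊥} (λ ())) , (λ _ ()) ⟩

  ⋁ₗ-∧ₗ : {X Y : Set} (f : X → Pair) (g : Y → Pair) →
    (⋁ₗ f ∧ₗ ⋁ₗ g) ⊑′ ⋁ₗ (λ (xy : X × Y) → f (proj₁ xy) ∧ₗ g (proj₂ xy))
  ⋁ₗ-∧ₗ f g = ⟨
    F₊.⋁ᴵ-∧ᴵ (λ x → f x ₊) (λ y → g y ₊) ,
    F₋.gen-least (L₋.⋀ᴵ (λ xy → (f (proj₁ xy) ∧ₗ g (proj₂ xy)) ₋))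
      (λ { (inj₁ u) (x , _) → L₋.inc (inj₁ (u x)) ; (inj₂ v) (_ , y) → L₋.inc (inj₂ (v y)) }) ⟩

  ⋁ₗ-∨ₗ : {X Y : Set} (f : X → Pair) (g : Y → Pair) → (⋁ₗ f ∨ₗ ⋁ₗ g) ⊑′ ⋁ₗ [ f , g ]′
  ⋁ₗ-∨ₗ f g = ⟨
    F₊.gen-least (L₊.⋁ᴵ (λ z → [ f , g ]′ z ₊))
      (λ { (inj₁ u) → F₊.gen-mono (λ (x , s) → inj₁ x , s) u
         ; (inj₂ v) → F₊.gen-mono (λ (y , s) → inj₂ y , s) v }) ,
    (λ { (u , v) (inj₁ x) → u x ; (u , v) (inj₂ y) → v y }) ⟩

  Basic⊆↓Con∧∨ : Pair → Set₁
  Basic⊆↓Con∧∨ α = ∀ {a b} → L₊.mem (α ₊) a → L₋.mem (α ₋) b → ↓ Con∧∨ ⟦ a , b ⟧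

  Con∧∨⇒Basic⊆↓Con∧∨ : ∀ {γ} → Con∧∨ γ → Basic⊆↓Con∧∨ γ
  Con∧∨⇒Basic⊆↓Con∧∨ {γ} c a∈γ₊ b∈γ₋ = γ , ⊑′⇒⊑ (⟦⟧⊑′ {γ} a∈γ₊ b∈γ₋) , c

module BelowCon∧⋁ (Π : PreDPres) where
  open PreDPres Π using (module B₊)
  open PD Π
  open Pairs Π

  -- ↓ Con∧⋁ γ with its family exposed, so that such families can be glued.
  record Below⋁Con∧ (γ : Pair) : Set₁ where
    field
      {Ix}  : Set
      fam   : Ix → Pair
      fam∈  : ∀ i → Con∧ (fam i)
      below : γ ⊑′ ⋁ₗ fam

    con∧⋁ : Con∧⋁ (⋁ₗ fam)
    con∧⋁ = mk fam fam∈
  open Below⋁Con∧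

  Below⋁Con∧-⊑′ : ∀ {α β} → α ⊑′ β → Below⋁Con∧ β → Below⋁Con∧ α
  Below⋁Con∧-⊑′ α⊑β w = record { fam = fam w ; fam∈ = fam∈ w ; below = ⊑′-trans α⊑β (below w) }

  Below⋁Con∧-∧ₗ : ∀ {α β} → Below⋁Con∧ α → Below⋁Con∧ β → Below⋁Con∧ (α ∧ₗ β)
  Below⋁Con∧-∧ₗ v w = record
    { fam   = λ (x , y) → fam v x ∧ₗ fam w y
    ; fam∈  = λ (x , y) → meet (fam∈ v x) (fam∈ w y)
    ; below = ⊑′-trans (∧ₗ-mono (below v) (below w)) (⋁ₗ-∧ₗ (fam v) (fam w)) }

  Below⋁Con∧-∨ₗ : ∀ {α β} → Below⋁Con∧ α → Below⋁Con∧ β → Below⋁Con∧ (α ∨ₗ β)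
  Below⋁Con∧-∨ₗ v w = record
    { fam   = [ fam v , fam w ]′
    ; fam∈  = λ { (inj₁ x) → fam∈ v x ; (inj₂ y) → fam∈ w y }
    ; below = ⊑′-trans (∨ₗ-mono (below v) (below w)) (⋁ₗ-∨ₗ (fam v) (fam w)) }

  Below⋁Con∧-⋁ₗ : {K : Set} {γ : K → Pair} → (∀ k → Below⋁Con∧ (γ k)) → Below⋁Con∧ (⋁ₗ γ)
  Below⋁Con∧-⋁ₗ {K} w = record
    { fam   = glued
    ; fam∈  = λ (k , i) → fam∈ (w k) i
    ; below = ⟨ F₊.gen-least (⋁ₗ glued ₊)
                  (λ (k , u) → F₊.gen-mono (λ (i , s) → (k , i) , s) (⊆₊ (below (w k)) u))
              , (λ v (k , i) → ⊆₋ (below (w k)) (v k) i) ⟩ }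
    where
    glued : Σ K (Ix ∘ w) → Pair
    glued (k , i) = fam (w k) i

  Con∧∨⇒Below⋁Con∧ : ∀ {γ} → Con∧∨ γ → Below⋁Con∧ γ
  Con∧∨⇒Below⋁Con∧ (base p) = record { fam = λ _ → _ ; fam∈ = λ _ → base p ; below = ⊑′⋁ₗ-singleton }
  Con∧∨⇒Below⋁Con∧ top      = record { fam = λ _ → _ ; fam∈ = λ _ → top ; below = ⊑′⋁ₗ-singleton }
  Con∧∨⇒Below⋁Con∧ bot      = record { fam = λ () ; fam∈ = λ () ; below = ffₗ⊑′⋁ₗ-empty }
  Con∧∨⇒Below⋁Con∧ (meet c d) = Below⋁Con∧-∧ₗ (Con∧∨⇒Below⋁Con∧ c) (Con∧∨⇒Below⋁Con∧ d)
  Con∧∨⇒Below⋁Con∧ (join c d) = Below⋁Con∧-∨ₗ (Con∧∨⇒Below⋁Con∧ c) (Con∧∨⇒Below⋁Con∧ d)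

  ↓Con∧∨⇒Below⋁Con∧ : ∀ {α} → ↓ Con∧∨ α → Below⋁Con∧ α
  ↓Con∧∨⇒Below⋁Con∧ (_ , α⊑γ , c) = Below⋁Con∧-⊑′ (⊑⇒⊑′ α⊑γ) (Con∧∨⇒Below⋁Con∧ c)

  module _ (ind : ind₊) where
    Below⋁Con∧⇒↓Con∧∨ : ∀ {a b} → Below⋁Con∧ ⟦ a , b ⟧ → ↓ Con∧∨ ⟦ a , b ⟧
    Below⋁Con∧⇒↓Con∧∨ {a} {b} w = ind a b (_ , ⊑′⇒⊑ (below w) , con∧⋁ w)

    ↓Con∧∨-Gen₊ : ∀ {S b} → (∀ {a} → S a → ↓ Con∧∨ ⟦ a , b ⟧) →
      ∀ {a} → L₊.Gen S a → ↓ Con∧∨ ⟦ a , b ⟧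
    ↓Con∧∨-Gen₊ {b = b} S⊆ =
      Below⋁Con∧⇒↓Con∧∨ ∘ F₊.Gen-ind (λ a → Below⋁Con∧ ⟦ a , b ⟧) (↓Con∧∨⇒Below⋁Con∧ ∘ S⊆) down cover
      where
      down : ∀ {a a′} → a′ B₊.≤ a → Below⋁Con∧ ⟦ a , b ⟧ → Below⋁Con∧ ⟦ a′ , b ⟧
      down a′≤a = Below⋁Con∧-⊑′ (⟦⟧⊑′ (L₊.dn a′≤a F₊.↑-self) F₋.↑-self)

      cover : ∀ {a} (c : B₊.Cov a) → (∀ i → Below⋁Con∧ ⟦ B₊.elem c i , b ⟧) → Below⋁Con∧ ⟦ a , b ⟧
      cover c w = Below⋁Con∧-⊑′ (⟦⟧⊑′ (L₊.cov c (λ i → L₊.inc (i , F₊.↑-self))) (λ _ → F₋.↑-self))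
                    (Below⋁Con∧-⋁ₗ w)

_ᵒᵖ : PreDPres → PreDPres
Π ᵒᵖ = record { P₊ = P₋ ; P₋ = P₊ ; con₁ = flip con₁ ; tot₁ = flip tot₁ }
  where open PreDPres Π

module Opposite (Π : PreDPres) where
  open PD Π
  private module Op = PD (Π ᵒᵖ)

  Con∧-op : ∀ {α} → Con∧ α → Op.Con∨ (swap α)
  Con∧-op (base p)   = Op.base p
  Con∧-op top        = Op.bot
  Con∧-op (meet c d) = Op.join (Con∧-op c) (Con∧-op d)

  Con∧⋁-op : ∀ {α} → Con∧⋁ α → Op.Con∨⋀ (swap α)
  Con∧⋁-op (mk f f∈) = Op.mk (swap ∘ f) (Con∧-op ∘ f∈)

  Con∧∨-op : ∀ {α} → Con∧∨ α → Op.Con∧∨ (swap α)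
  Con∧∨-op (base p)   = Op.base p
  Con∧∨-op top        = Op.bot
  Con∧∨-op bot        = Op.top
  Con∧∨-op (meet c d) = Op.join (Con∧∨-op c) (Con∧∨-op d)
  Con∧∨-op (join c d) = Op.meet (Con∧∨-op c) (Con∧∨-op d)

  Tot∧-op : ∀ {α} → Tot∧ α → Op.Tot∨ (swap α)
  Tot∧-op (base p)   = Op.base p
  Tot∧-op top        = Op.bot
  Tot∧-op (meet t u) = Op.join (Tot∧-op t) (Tot∧-op u)

  Tot*-op : ∀ {α} → Tot* α → Op.Tot* (swap α)
  Tot*-op (t-base p)  = Op.t-base p
  Tot*-op t-tt        = Op.t-ff
  Tot*-op t-ff        = Op.t-tt
  Tot*-op (t-up p t)  = Op.t-up (swap p) (Tot*-op t)
  Tot*-op (t-∧ t u)   = Op.t-∨ (Tot*-op t) (Tot*-op u)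
  Tot*-op (t-∨ t u)   = Op.t-∧ (Tot*-op t) (Tot*-op u)

  ↓-op : ∀ {R : Pair → Set₁} {S : Op.Pair → Set₁} → (∀ {γ} → R γ → S (swap γ)) →
    ∀ {α} → ↓ R α → Op.↓ S (swap α)
  ↓-op R⇒S (γ , α⊑γ , r) = swap γ , swap α⊑γ , R⇒S r

module Duality (Π : PreDPres) where
  open PD Π
  open Pairs Π using (Basic⊆↓Con∧∨)
  open Opposite Π
  private
    module Op = PD (Π ᵒᵖ)
    module Op-Pairs = Pairs (Π ᵒᵖ)
    module Op-Opposite = Opposite (Π ᵒᵖ)

  ↓Con∧∨-op : ∀ α → ↓ Con∧∨ α → Op.↓ Op.Con∧∨ (swap α)
  ↓Con∧∨-op α = ↓-op {S = Op.Con∧∨} Con∧∨-op {α}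

  ↓Con∧∨-unop : ∀ α → Op.↓ Op.Con∧∨ α → ↓ Con∧∨ (swap α)
  ↓Con∧∨-unop α = Op-Opposite.↓-op {S = Con∧∨} Op-Opposite.Con∧∨-op {α}

  ind₋⇒ind₊ᵒᵖ : ind₋ → Op.ind₊
  ind₋⇒ind₊ᵒᵖ ind b a =
    ↓Con∧∨-op ⟦ a , b ⟧ ∘ ind a b ∘ Op-Opposite.↓-op {S = Con∨⋀} Op-Opposite.Con∧⋁-op {Op.⟦ b , a ⟧}

  λ4₋⇒λ4₊ᵒᵖ : λ4₋ → Op.λ4₊
  λ4₋⇒λ4₊ᵒᵖ λ4 α β c t = λ4 (swap α) (swap β) (Op-Opposite.Con∧⋁-op c) (Op-Opposite.Tot∧-op t)

  Basic⊆↓Con∧∨-op : ∀ {α} → Basic⊆↓Con∧∨ α → Op-Pairs.Basic⊆↓Con∧∨ (swap α)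
  Basic⊆↓Con∧∨-op α-basic {b} {a} b∈α₋ a∈α₊ = ↓Con∧∨-op ⟦ a , b ⟧ (α-basic a∈α₊ b∈α₋)

module ConStar (Π : PreDPres) (ind₊-hyp : PD.ind₊ Π) (ind₋-hyp : PD.ind₋ Π) where
  open PD Π
  open Pairs Π
  open Duality Π
  private
    module Op = PD (Π ᵒᵖ)
    module Op-BelowCon∧⋁ = BelowCon∧⋁ (Π ᵒᵖ)

  ↓Con∧∨-Gen₊ : ∀ {S b} → (∀ {a} → S a → ↓ Con∧∨ ⟦ a , b ⟧) → ∀ {a} → L₊.Gen S a → ↓ Con∧∨ ⟦ a , b ⟧
  ↓Con∧∨-Gen₊ = BelowCon∧⋁.↓Con∧∨-Gen₊ Π ind₊-hyp

  ↓Con∧∨-Gen₋ : ∀ {S a} → (∀ {b} → S b → ↓ Con∧∨ ⟦ a , b ⟧) → ∀ {b} → L₋.Gen S b → ↓ Con∧∨ ⟦ a , b ⟧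
  ↓Con∧∨-Gen₋ {a = a} S⊆ {b} =
    ↓Con∧∨-unop Op.⟦ b , a ⟧ ∘
    Op-BelowCon∧⋁.↓Con∧∨-Gen₊ (ind₋⇒ind₊ᵒᵖ ind₋-hyp) (λ {b′} s → ↓Con∧∨-op ⟦ a , b′ ⟧ (S⊆ s))

  Con*⇒Basic⊆↓Con∧∨ : ∀ {α} → Con* α → Basic⊆↓Con∧∨ α
  Con*⇒Basic⊆↓Con∧∨ (c-base p) = Con∧∨⇒Basic⊆↓Con∧∨ (base p)
  Con*⇒Basic⊆↓Con∧∨ c-tt       = Con∧∨⇒Basic⊆↓Con∧∨ top
  Con*⇒Basic⊆↓Con∧∨ c-ff       = Con∧∨⇒Basic⊆↓Con∧∨ bot
  Con*⇒Basic⊆↓Con∧∨ (c-down (p , q) c) u v = Con*⇒Basic⊆↓Con∧∨ c (p u) (q v)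
  Con*⇒Basic⊆↓Con∧∨ (c-∧ c d) (u₁ , u₂) =
    ↓Con∧∨-Gen₋ [ Con*⇒Basic⊆↓Con∧∨ c u₁ , Con*⇒Basic⊆↓Con∧∨ d u₂ ]′
  Con*⇒Basic⊆↓Con∧∨ (c-∨ c d) u (v₁ , v₂) =
    ↓Con∧∨-Gen₊ [ (λ x → Con*⇒Basic⊆↓Con∧∨ c x v₁) , (λ y → Con*⇒Basic⊆↓Con∧∨ d y v₂) ]′ u
  Con*⇒Basic⊆↓Con∧∨ (c-dir f (_ , directed) c) u =
    ↓Con∧∨-Gen₋ λ (y , v) → ↓Con∧∨-Gen₊ (λ (x , u′) →
      let z , (fx⊑fz , _) , (_ , fy⊑fz) = directed x y
      in Con*⇒Basic⊆↓Con∧∨ (c z) (fx⊑fz u′) (fy⊑fz v)) u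

module TotStar (Π : PreDPres) where
  open PD Π
  open Pairs Π
  open BelowCon∧⋁ Π

  data ↑FinJoin (R : Pair → Set₁) : Pair → Set₁ where
    [_]  : ∀ {β} → R β → ↑FinJoin R β
    ff   : ↑FinJoin R ffₗ
    _∨ᶠ_ : ∀ {β γ} → ↑FinJoin R β → ↑FinJoin R γ → ↑FinJoin R (β ∨ₗ γ)
    up   : ∀ {β γ} → β ⊑′ γ → ↑FinJoin R β → ↑FinJoin R γ

  module _ {R : Pair → Set₁} (R-∧ₗ : ∀ {β γ} → R β → R γ → R (β ∧ₗ γ)) where
    ↑FinJoin-∧ₗ : ∀ {β γ} → ↑FinJoin R β → ↑FinJoin R γ → ↑FinJoin R (β ∧ₗ γ)
    ↑FinJoin-∧ₗ {γ = γ} (up p j) k = up (∧ₗ-mono p (⊑′-refl {γ})) (↑FinJoin-∧ₗ j k)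
    ↑FinJoin-∧ₗ {γ = γ} ff k = up (ffₗ⊑′ffₗ∧ₗ γ) ff
    ↑FinJoin-∧ₗ {γ = γ} (_∨ᶠ_ {β₁} {β₂} j₁ j₂) k =
      up (∧ₗ-distribʳ-∨ₗ γ β₁ β₂) (↑FinJoin-∧ₗ j₁ k ∨ᶠ ↑FinJoin-∧ₗ j₂ k)
    ↑FinJoin-∧ₗ {β} [ r ] (up p k) = up (∧ₗ-mono (⊑′-refl {β}) p) (↑FinJoin-∧ₗ [ r ] k)
    ↑FinJoin-∧ₗ {β} [ r ] ff = up (ffₗ⊑′∧ₗffₗ β) ff
    ↑FinJoin-∧ₗ {β} [ r ] (_∨ᶠ_ {γ₁} {γ₂} k₁ k₂) =
      up (∧ₗ-distribˡ-∨ₗ β γ₁ γ₂) (↑FinJoin-∧ₗ [ r ] k₁ ∨ᶠ ↑FinJoin-∧ₗ [ r ] k₂)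
    ↑FinJoin-∧ₗ [ r ] [ s ] = [ R-∧ₗ r s ]

  Tot*⇒↑FinJoinTot∧ : ∀ {β} → Tot* β → ↑FinJoin Tot∧ β
  Tot*⇒↑FinJoinTot∧ (t-base p) = [ base p ]
  Tot*⇒↑FinJoinTot∧ t-tt       = [ top ]
  Tot*⇒↑FinJoinTot∧ t-ff       = ff
  Tot*⇒↑FinJoinTot∧ (t-up p t) = up (⊑⇒⊑′ p) (Tot*⇒↑FinJoinTot∧ t)
  Tot*⇒↑FinJoinTot∧ (t-∧ t u)  = ↑FinJoin-∧ₗ meet (Tot*⇒↑FinJoinTot∧ t) (Tot*⇒↑FinJoinTot∧ u)
  Tot*⇒↑FinJoinTot∧ (t-∨ t u)  = Tot*⇒↑FinJoinTot∧ t ∨ᶠ Tot*⇒↑FinJoinTot∧ u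

  module _ (λ4 : λ4₊) {α} (α-basic : Basic⊆↓Con∧∨ α) where
    λ4₊-Tot∧ : ∀ {β} → Tot∧ β → (β ₊) L₊.⊆ᴵ (α ₊) → (α ₋) L₋.⊆ᴵ (β ₋)
    λ4₊-Tot∧ {β} t β₊⊆α₊ {b} b∈α₋ =
      λ4 (⋁ₗ fam) β con∧⋁ t (⊆₊ below ∘ β₊⊆⋁basic) (⊆₋ below (λ _ → F₋.↑-self))
      where
      basic : Σ _ (L₊.mem (β ₊)) → Pair
      basic (a , _) = ⟦ a , b ⟧

      β₊⊆⋁basic : (β ₊) L₊.⊆ᴵ (⋁ₗ basic ₊)
      β₊⊆⋁basic {a} a∈β₊ = L₊.inc ((a , a∈β₊) , F₊.↑-self)

      open Below⋁Con∧ (Below⋁Con∧-⋁ₗ {γ = basic} λ (_ , a∈β₊) →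
        ↓Con∧∨⇒Below⋁Con∧ (α-basic (β₊⊆α₊ a∈β₊) b∈α₋))

    λ4₊-↑FinJoin : ∀ {β} → ↑FinJoin Tot∧ β → (β ₊) L₊.⊆ᴵ (α ₊) → (α ₋) L₋.⊆ᴵ (β ₋)
    λ4₊-↑FinJoin [ t ]      = λ4₊-Tot∧ t
    λ4₊-↑FinJoin ff         = λ _ _ → tt
    λ4₊-↑FinJoin (j ∨ᶠ k) β₊⊆α₊ b∈α₋ =
      λ4₊-↑FinJoin j (λ u → β₊⊆α₊ (L₊.inc (inj₁ u))) b∈α₋ ,
      λ4₊-↑FinJoin k (λ u → β₊⊆α₊ (L₊.inc (inj₂ u))) b∈α₋
    λ4₊-↑FinJoin (up p j) β₊⊆α₊ b∈α₋ = ⊆₋ p (λ4₊-↑FinJoin j (β₊⊆α₊ ∘ ⊆₊ p) b∈α₋)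

    λ4₊-Tot* : ∀ {β} → Tot* β → (β ₊) L₊.⊆ᴵ (α ₊) → (α ₋) L₋.⊆ᴵ (β ₋)
    λ4₊-Tot* = λ4₊-↑FinJoin ∘ Tot*⇒↑FinJoinTot∧

theorem16 : (Π : PreDPres) →
    PD.λ4₊ Π → PD.λ4₋ Π → PD.ind₊ Π → PD.ind₋ Π → PD.con-tot Π
theorem16 Π λ4₊ λ4₋ ind₊ ind₋ α β con tot = [ from₊ , from₋ ]′
  where
  open Duality Π
  open Opposite Π
  open PD Π using (_₊; _₋; _⊑_; module L₊; module L₋)

  α-basic : Pairs.Basic⊆↓Con∧∨ Π α
  α-basic = ConStar.Con*⇒Basic⊆↓Con∧∨ Π ind₊ ind₋ con

  from₊ : (α ₊) L₊.≅ᴵ (β ₊) → α ⊑ β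
  from₊ (α₊⊆β₊ , β₊⊆α₊) = α₊⊆β₊ , TotStar.λ4₊-Tot* Π λ4₊ {α} α-basic tot β₊⊆α₊

  from₋ : (α ₋) L₋.≅ᴵ (β ₋) → α ⊑ β
  from₋ (α₋⊆β₋ , β₋⊆α₋) =
    TotStar.λ4₊-Tot* (Π ᵒᵖ) (λ4₋⇒λ4₊ᵒᵖ λ4₋) {swap α} (Basic⊆↓Con∧∨-op {α} α-basic)
      (Tot*-op {β} tot) β₋⊆α₋ ,
    α₋⊆β₋
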